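{- A set $\mathcal{R}$ of rooted triplets is caterpillar-compatible if and only if its triplet digraph $D(\mathcal{R})$ is acyclic.
   Context: A (rooted) triplet $ab|c$ (equal to $ba|c$) on distinct labels $a,b,c$ is the binary rooted tree on leaves $a,b,c$ in which $a,b$ share a parent. A binary rooted phylogenetic tree on a label set $X$ is a rooted tree, edges directed away from the root, root of out-degree 2, other internal vertices of in-degree 1 and out-degree 2, with leaves bijectively labelled by $X$; a caterpillar is such a tree with exactly one cherry (pair of leaves with a common parent). A tree $T$ displays $ab|c$ if $\mathrm{lca}_T(a,c)=\mathrm{lca}_T(b,c)$ is a proper ancestor of $\mathrm{lca}_T(a,b)$. For a set $\mathcal{R}$ of triplets with label set $X$, $\mathcal{R}$ is caterpillar-compatible if there is a caterpillar on $X$ displaying every triplet of $\mathcal{R}$, and the triplet digraph $D(\mathcal{R})$ has vertex set $X$ and arcs $(c,a)$ and $(c,b)$ for each $ab|c\in\mathcal{R}$. -}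

module Defs where

open import Data.Nat using (ℕ; zero; suc; _+_)
open import Data.Bool using (Bool; true; false)
open import Data.List using (List; []; _∷_; _++_)
open import Data.List.Membership.Propositional using (_∈_)
open import Data.List.Relation.Unary.Unique.Propositional using (Unique)
open import Data.Product using (Σ; ∃; ∃-syntax; _×_; _,_)
open import Data.Sum using (_⊎_)
open import Relation.Binary.PropositionalEquality using (_≡_; _≢_)
open import Relation.Binary.Construct.Closure.Transitive using (TransClosure)
open import Relation.Nullary using (¬_)
open import Function.Bundles using (_⇔_)

Label : Set
Label = ℕ

-- A rooted triplet ab|c on three distinct labels (ab|c and ba|c are
-- interchangeable: every notion below is symmetric in a and b).
record Triplet : Set where
  constructor _∣∣_
  field
    a b c : Label
    a≢b : a ≢ b
    a≢c : a ≢ c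
    b≢c : b ≢ c
open Triplet public

_∈L_ : Label → List Triplet → Set
x ∈L R = ∃[ t ] (t ∈ R × (x ≡ a t ⊎ x ≡ b t ⊎ x ≡ c t))

-- Rooted binary trees with labelled leaves.  A vertex of a tree is
-- identified with its path from the root (false = left child,
-- true = right child); ancestors are prefixes.

data BTree : Set where
  leaf : Label → BTree
  node : BTree → BTree → BTree

leaves : BTree → List Label
leaves (leaf x)   = x ∷ []
leaves (node l r) = leaves l ++ leaves r

data LeafAt : BTree → List Bool → Label → Set where
  here  : ∀ {x} → LeafAt (leaf x) [] x
  left  : ∀ {l r p x} → LeafAt l p x → LeafAt (node l r) (false ∷ p) x
  right : ∀ {l r p x} → LeafAt r p x → LeafAt (node l r) (true ∷ p) x

-- lowest common ancestor of two vertices = longest common prefix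
lcp : List Bool → List Bool → List Bool
lcp (false ∷ p) (false ∷ q) = false ∷ lcp p q
lcp (true ∷ p)  (true ∷ q)  = true ∷ lcp p q
lcp _           _           = []

data ProperAncestor : List Bool → List Bool → Set where
  stop : ∀ {β v} → ProperAncestor [] (β ∷ v)
  step : ∀ {β u v} → ProperAncestor u v → ProperAncestor (β ∷ u) (β ∷ v)

Displays : BTree → Triplet → Set
Displays T t =
  ∃[ pa ] ∃[ pb ] ∃[ pc ]
    ( LeafAt T pa (a t) × LeafAt T pb (b t) × LeafAt T pc (c t)
    × lcp pa pc ≡ lcp pb pc
    × ProperAncestor (lcp pa pc) (lcp pa pb))

cherries : BTree → ℕ
cherries (leaf _)                 = 0
cherries (node (leaf _) (leaf _)) = 1
cherries (node l r)               = cherries l + cherries r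

data IsNode : BTree → Set where
  isNode : ∀ {l r} → IsNode (node l r)

PhyloTreeOn : List Triplet → BTree → Set
PhyloTreeOn R T =
  IsNode T × Unique (leaves T) × (∀ x → (x ∈ leaves T ⇔ x ∈L R))

CaterpillarOn : List Triplet → BTree → Set
CaterpillarOn R T = PhyloTreeOn R T × cherries T ≡ 1

CaterpillarCompatible : List Triplet → Set
CaterpillarCompatible R = ∃[ T ] (CaterpillarOn R T × (∀ t → t ∈ R → Displays T t))

Arc : List Triplet → Label → Label → Set
Arc R u v = ∃[ t ] (t ∈ R × u ≡ c t × (v ≡ a t ⊎ v ≡ b t))

Acyclic : List Triplet → Set
Acyclic R = ∀ v → ¬ TransClosure (Arc R) v v

-- (⇒) In a caterpillar every internal vertex has a leaf child, so if the
-- caterpillar displays ab|c then the leaf c hangs strictly higher than a and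
-- b.  Hence every arc of D(R) strictly increases leaf depth, and a digraph
-- whose arcs strictly increase a rank has no directed cycle.
--
-- (⇐) A finite acyclic digraph with decidable arcs has a source in every
-- non-empty vertex list (by induction, contracting the head vertex), hence a
-- topological order (no arc points backwards).
-- Listing the labels of R in such an order x₁,…,xₙ (n ≥ 2) as the caterpillar
-- (x₁,(x₂,(…,(xₙ₋₁,xₙ)))) displays every ab|c ∈ R, because the arcs c→a and
-- c→b force c to come before a and b.
module Submission where

open import Defs
open import Data.List using (List; [])
open import Relation.Binary.PropositionalEquality using (_≢_)
open import Function.Bundles using (_⇔_)

open import Data.Nat using (ℕ; _≤_; _<_; z≤n; s≤s)
open import Data.Nat.Properties using (≤-refl; ≤-trans; <-trans; <-irrefl; m≤m+n; +-mono-≤)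
open import Data.Nat.Induction using (<-wellFounded)
open import Induction.WellFounded using (Acc; acc)
open import Data.Bool using (true; false)
open import Data.List using (_∷_; _++_; length; filter)
open import Data.List.Properties using (filter-notAll)
open import Data.List.Relation.Unary.Any as Any using (here; there; any?)
open import Data.List.Relation.Unary.All as All using (All; _∷_)
open import Data.List.Relation.Unary.AllPairs using (AllPairs; _∷_; [])
open import Data.List.Membership.Propositional using (_∈_; find; lose)
open import Data.List.Membership.Propositional.Properties
  using (∈-++⁺ˡ; ∈-++⁺ʳ; ∈-++⁻; ∈-filter⁺; ∈-filter⁻)
open import Data.List.Relation.Unary.Unique.Propositional using (Unique)
open import Data.Product using (∃₂; ∃-syntax; _×_; _,_; proj₁; proj₂)
open import Data.Sum using (_⊎_; inj₁; inj₂)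
open import Data.Empty using (⊥-elim)
open import Relation.Nullary using (¬_; Dec; yes; no; ¬?)
open import Relation.Nullary.Decidable using (map′; _×-dec_; _⊎-dec_)
open import Relation.Binary using (Rel; Decidable; DecidableEquality)
open import Relation.Binary.PropositionalEquality using (_≡_; refl; sym; trans; cong; subst; subst₂)
open import Relation.Binary.Construct.Closure.Transitive as Plus using (TransClosure; [_]; _∷_)
open import Function.Bundles using (mk⇔; Equivalence)
open import Function.Construct.Composition using (_⇔-∘_)
open import Level using (0ℓ)

open Data.Nat using (_≟_)

module Digraph {A : Set} where

  NoCycle : Rel A 0ℓ → Set
  NoCycle E = ∀ v → ¬ TransClosure E v v

  module _ (E : Rel A 0ℓ) (Rank : A → ℕ → Set)
           (functional : ∀ {x m n} → Rank x m → Rank x n → m ≡ n)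
           (increasing : ∀ {u v} → E u v → ∃₂ λ m n → Rank u m × Rank v n × m < n) where

    walk-increases : ∀ {u w} → TransClosure E u w → ∃₂ λ m n → Rank u m × Rank w n × m < n
    walk-increases [ e ] = increasing e
    walk-increases (e ∷ es)
      with m , k , ru , rx , m<k ← increasing e
         | k′ , n , rx′ , rw , k′<n ← walk-increases es
      rewrite functional rx rx′ = m , n , ru , rw , <-trans m<k k′<n

    no-cycle-by-rank : NoCycle E
    no-cycle-by-rank v cycle
      with m , n , rv , rv′ , m<n ← walk-increases cycle
      rewrite functional rv rv′ = <-irrefl refl m<n

  Bypass : Rel A 0ℓ → A → Rel A 0ℓ
  Bypass E x u v = E u v ⊎ (E u x × E x v)

  bypass? : ∀ {E} → Decidable E → ∀ x → Decidable (Bypass E x)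
  bypass? E? x u v = E? u v ⊎-dec (E? u x ×-dec E? x v)

  -- Bypassing a vertex creates no cycles: bypass arcs are walks of E.
  bypass-acyclic : ∀ {E} → NoCycle E → ∀ x → NoCycle (Bypass E x)
  bypass-acyclic {E} acyclic x v cycle = acyclic v (expand cycle)
    where
    arc : ∀ {u w} → Bypass E x u w → TransClosure E u w
    arc (inj₁ e)        = [ e ]
    arc (inj₂ (e , e′)) = e ∷ [ e′ ]

    expand : ∀ {u w} → TransClosure (Bypass E x) u w → TransClosure E u w
    expand [ e ]    = arc e
    expand (e ∷ es) = arc e Plus.++ expand es

  IsSource : Rel A 0ℓ → List A → A → Set
  IsSource E S s = s ∈ S × (∀ {u} → u ∈ S → ¬ E u s)

  -- If the head x has an in-neighbour p in the tail, a source of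
  -- the tail for the relation that bypasses x is a source of the whole list.
  source : (E : Rel A 0ℓ) → Decidable E → NoCycle E
         → ∀ {x} (S : List A) → x ∈ S → ∃[ s ] IsSource E S s
  source E E? acyclic (x ∷ xs) _ with any? (λ u → E? u x) (x ∷ xs)
  ... | no noPred = x , here refl , λ u∈S e → noPred (lose u∈S e)
  ... | yes pred with find pred
  ...   | _ , here refl , e = ⊥-elim (acyclic x [ e ])
  ...   | p , there p∈xs , p→x
    with s , s∈xs , noIn ← source (Bypass E x) (bypass? E? x) (bypass-acyclic acyclic x) xs p∈xs
    = s , there s∈xs , noIn′
    where
    noIn′ : ∀ {u} → u ∈ x ∷ xs → ¬ E u s
    noIn′ (here refl)  x→s = noIn p∈xs (inj₂ (p→x , x→s))
    noIn′ (there u∈xs) u→s = noIn u∈xs (inj₁ u→s)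

  Topological : Rel A 0ℓ → List A → Set
  Topological E = AllPairs (λ earlier later → ¬ E later earlier)

  -- An acyclic digraph with decidable arcs has a topological order of any
  -- finite vertex list: put a source first and sort the remaining vertices.
  module _ (_≟ᴬ_ : DecidableEquality A) (E : Rel A 0ℓ) (E? : Decidable E)
           (acyclic : NoCycle E) where

    differs? : (s y : A) → Dec (y ≢ s)
    differs? s y = ¬? (y ≟ᴬ s)

    without : A → List A → List A
    without s = filter (differs? s)

    without-shorter : ∀ {s} S → s ∈ S → length (without s S) < length S
    without-shorter S s∈S = filter-notAll (differs? _) S (Any.map (λ s≡y y≢s → y≢s (sym s≡y)) s∈S)

    TopologicalSort : List A → List A → Set
    TopologicalSort S L = (∀ x → x ∈ L ⇔ x ∈ S) × Unique L × Topological E L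

    topological-sort : (S : List A) → ∃[ L ] TopologicalSort S L
    topological-sort S = sort S (<-wellFounded (length S))
      where
      sort : (S : List A) → Acc _<_ (length S) → ∃[ L ] TopologicalSort S L
      sort [] _ = [] , (λ _ → mk⇔ (λ ()) (λ ())) , [] , []
      sort S@(x ∷ _) (acc smaller)
        with s , s∈S , noIn ← source E E? acyclic S (here refl)
        with L , L⇔ , uniq , topo ← sort (without s S) (smaller (without-shorter S s∈S))
        = s ∷ L , s∷L⇔S , All.tabulate (λ y∈L s≡y → proj₂ (in-rest y∈L) (sym s≡y)) ∷ uniq
                 , All.tabulate (λ y∈L → noIn (proj₁ (in-rest y∈L))) ∷ topo
        where
        in-rest : ∀ {y} → y ∈ L → y ∈ S × y ≢ s
        in-rest y∈L = ∈-filter⁻ (differs? s) (Equivalence.to (L⇔ _) y∈L)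

        s∷L⇔S : ∀ y → y ∈ s ∷ L ⇔ y ∈ S
        s∷L⇔S y = mk⇔ to from
          where
          to : y ∈ s ∷ L → y ∈ S
          to (here refl) = s∈S
          to (there y∈L) = proj₁ (in-rest y∈L)
          from : y ∈ S → y ∈ s ∷ L
          from y∈S with y ≟ᴬ s
          ... | yes refl = here refl
          ... | no y≢s   = there (Equivalence.from (L⇔ y) (∈-filter⁺ (differs? s) y∈S y≢s))

open Digraph

unique-++ˡ : ∀ {A : Set} {xs ys : List A} → Unique (xs ++ ys) → Unique xs
unique-++ˡ {xs = []}     _        = []
unique-++ˡ {xs = _ ∷ xs} (x∉ ∷ u) = All.tabulate (λ m → All.lookup x∉ (∈-++⁺ˡ m)) ∷ unique-++ˡ u

unique-++ʳ : ∀ {A : Set} {xs ys : List A} → Unique (xs ++ ys) → Unique ys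
unique-++ʳ {xs = []}     u       = u
unique-++ʳ {xs = _ ∷ xs} (_ ∷ u) = unique-++ʳ {xs = xs} u

unique-++-disjoint : ∀ {A : Set} {x : A} {xs ys} → Unique (xs ++ ys) → x ∈ xs → ¬ x ∈ ys
unique-++-disjoint {xs = _ ∷ xs} (x∉ ∷ _) (here refl) x∈ys = All.lookup x∉ (∈-++⁺ʳ xs x∈ys) refl
unique-++-disjoint {xs = _ ∷ xs} (_ ∷ u)  (there x∈xs) x∈ys = unique-++-disjoint u x∈xs x∈ys

leafAt-leaf : ∀ {T p x} → LeafAt T p x → x ∈ leaves T
leafAt-leaf here      = here refl
leafAt-leaf (left h)  = ∈-++⁺ˡ (leafAt-leaf h)
leafAt-leaf {node l r} (right h) = ∈-++⁺ʳ (leaves l) (leafAt-leaf h)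

leaf-leafAt : ∀ T {x} → x ∈ leaves T → ∃[ p ] LeafAt T p x
leaf-leafAt (leaf _) (here refl) = [] , here
leaf-leafAt (node l r) x∈T with ∈-++⁻ (leaves l) x∈T
... | inj₁ x∈l = let p , h = leaf-leafAt l x∈l in false ∷ p , left h
... | inj₂ x∈r = let p , h = leaf-leafAt r x∈r in true ∷ p , right h

leafAt-unique : ∀ {T p q x} → Unique (leaves T) → LeafAt T p x → LeafAt T q x → p ≡ q
leafAt-unique u here here = refl
leafAt-unique u (left h) (left h′) = cong (false ∷_) (leafAt-unique (unique-++ˡ u) h h′)
leafAt-unique {node l r} u (right h) (right h′) =
  cong (true ∷_) (leafAt-unique (unique-++ʳ {xs = leaves l} u) h h′)
leafAt-unique u (left h)  (right h′) = ⊥-elim (unique-++-disjoint u (leafAt-leaf h) (leafAt-leaf h′))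
leafAt-unique u (right h) (left h′)  = ⊥-elim (unique-++-disjoint u (leafAt-leaf h′) (leafAt-leaf h))

distinct-leaves-below-root : ∀ {T p q x y} → LeafAt T p x → LeafAt T q y → x ≢ y → 0 < length p
distinct-leaves-below-root here here x≢y = ⊥-elim (x≢y refl)
distinct-leaves-below-root (left _)  _ _ = s≤s z≤n
distinct-leaves-below-root (right _) _ _ = s≤s z≤n

lcp-comm : ∀ p q → lcp p q ≡ lcp q p
lcp-comm []          []          = refl
lcp-comm []          (false ∷ _) = refl
lcp-comm []          (true ∷ _)  = refl
lcp-comm (false ∷ _) []          = refl
lcp-comm (true ∷ _)  []          = refl
lcp-comm (false ∷ p) (false ∷ q) = cong (false ∷_) (lcp-comm p q)
lcp-comm (false ∷ _) (true ∷ _)  = refl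
lcp-comm (true ∷ _)  (false ∷ _) = refl
lcp-comm (true ∷ p)  (true ∷ q)  = cong (true ∷_) (lcp-comm p q)

data Caterpillar : BTree → Set where
  tip        : ∀ {x} → Caterpillar (leaf x)
  leaf-left  : ∀ {x r} → Caterpillar r → Caterpillar (node (leaf x) r)
  leaf-right : ∀ {x l} → Caterpillar l → Caterpillar (node l (leaf x))

left-caterpillar : ∀ {l r} → Caterpillar (node l r) → Caterpillar l
left-caterpillar (leaf-left _)  = tip
left-caterpillar (leaf-right c) = c

right-caterpillar : ∀ {l r} → Caterpillar (node l r) → Caterpillar r
right-caterpillar (leaf-left c)  = c
right-caterpillar (leaf-right _) = tip

node-has-cherry : ∀ l r → 1 ≤ cherries (node l r)
node-has-cherry (leaf _)   (leaf _)     = ≤-refl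
node-has-cherry (leaf _)   (node l r)   = node-has-cherry l r
node-has-cherry (node l r) (leaf _)     = ≤-trans (node-has-cherry l r) (m≤m+n _ 0)
node-has-cherry (node l r) (node l′ r′) = ≤-trans (node-has-cherry l r) (m≤m+n _ _)

-- A tree with at most one cherry has caterpillar shape: two internal
-- children would carry a cherry each.
caterpillar-shape : ∀ T → cherries T ≤ 1 → Caterpillar T
caterpillar-shape (leaf _) _ = tip
caterpillar-shape (node (leaf _) (leaf _))     _ = leaf-left tip
caterpillar-shape (node (leaf _) (node l r))   h = leaf-left (caterpillar-shape (node l r) h)
caterpillar-shape (node (node l r) (leaf _))   h =
  leaf-right (caterpillar-shape (node l r) (≤-trans (m≤m+n _ 0) h))
caterpillar-shape (node (node l r) (node l′ r′)) h =
  ⊥-elim (<-irrefl refl (≤-trans (+-mono-≤ (node-has-cherry l r) (node-has-cherry l′ r′)) h))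

-- If one child of a caterpillar carries two distinct leaves, the other child
-- is a leaf, so the path into it is empty.
sibling-of-leftˡ : ∀ {l r p q pc x y z} → Caterpillar (node l r)
                 → LeafAt l p x → LeafAt l q y → x ≢ y → LeafAt r pc z → length pc ≡ 0
sibling-of-leftˡ (leaf-left _)  here here x≢y _ = ⊥-elim (x≢y refl)
sibling-of-leftˡ (leaf-right _) _    _    _   here = refl

sibling-of-rightʳ : ∀ {l r p q pc x y z} → Caterpillar (node l r)
                  → LeafAt r p x → LeafAt r q y → x ≢ y → LeafAt l pc z → length pc ≡ 0
sibling-of-rightʳ (leaf-right _) here here x≢y _ = ⊥-elim (x≢y refl)
sibling-of-rightʳ (leaf-left _)  _    _    _   here = refl

outgroup-higher : ∀ {T pa pb pc x y z} → Caterpillar T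
                → LeafAt T pa x → LeafAt T pb y → LeafAt T pc z → x ≢ y
                → ProperAncestor (lcp pa pc) (lcp pa pb) → length pc < length pa
outgroup-higher c (left La) (left Lb) (left Lc) x≢y (step anc) =
  s≤s (outgroup-higher (left-caterpillar c) La Lb Lc x≢y anc)
outgroup-higher c (right La) (right Lb) (right Lc) x≢y (step anc) =
  s≤s (outgroup-higher (right-caterpillar c) La Lb Lc x≢y anc)
outgroup-higher c (left La) (left Lb) (right Lc) x≢y stop
  rewrite sibling-of-leftˡ c La Lb x≢y Lc = s≤s (distinct-leaves-below-root La Lb x≢y)
outgroup-higher c (right La) (right Lb) (left Lc) x≢y stop
  rewrite sibling-of-rightʳ c La Lb x≢y Lc = s≤s (distinct-leaves-below-root La Lb x≢y)
outgroup-higher c (left _)  (right _) _ _ ()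
outgroup-higher c (right _) (left _)  _ _ ()

Depth : BTree → Label → ℕ → Set
Depth T x n = ∃[ p ] (LeafAt T p x × length p ≡ n)

depth-functional : ∀ {T x m n} → Unique (leaves T) → Depth T x m → Depth T x n → m ≡ n
depth-functional u (p , Lp , refl) (q , Lq , refl) = cong length (leafAt-unique u Lp Lq)

displayed-outgroup-higher : ∀ {T} t → Caterpillar T → Displays T t → ∀ {v} → v ≡ a t ⊎ v ≡ b t
                          → ∃₂ λ m n → Depth T (c t) m × Depth T v n × m < n
displayed-outgroup-higher t cat (pa , pb , pc , La , Lb , Lc , lcaᵃᶜ≡lcaᵇᶜ , anc) (inj₁ refl) =
  _ , _ , (pc , Lc , refl) , (pa , La , refl) , outgroup-higher cat La Lb Lc (a≢b t) anc
displayed-outgroup-higher t cat (pa , pb , pc , La , Lb , Lc , lcaᵃᶜ≡lcaᵇᶜ , anc) (inj₂ refl) =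
  _ , _ , (pc , Lc , refl) , (pb , Lb , refl)
    , outgroup-higher cat Lb La Lc (λ e → a≢b t (sym e)) anc′
  where
  anc′ : ProperAncestor (lcp pb pc) (lcp pb pa)
  anc′ = subst₂ ProperAncestor lcaᵃᶜ≡lcaᵇᶜ (lcp-comm pa pb) anc

-- A caterpillar with distinct leaf labels displaying every triplet of R
-- makes D(R) acyclic: arcs strictly increase depth.
caterpillar-acyclic : ∀ R T → Caterpillar T → Unique (leaves T)
                    → (∀ t → t ∈ R → Displays T t) → Acyclic R
caterpillar-acyclic R T cat u displays =
  no-cycle-by-rank (Arc R) (Depth T) (depth-functional u) arc-descends
  where
  arc-descends : ∀ {x y} → Arc R x y → ∃₂ λ m n → Depth T x m × Depth T y n × m < n
  arc-descends (t , t∈R , refl , y∈ab) = displayed-outgroup-higher t cat (displays t t∈R) y∈ab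

spine : Label → List Label → BTree
spine x []       = leaf x
spine x (y ∷ ys) = node (leaf x) (spine y ys)

spine-leaves : ∀ x ys → leaves (spine x ys) ≡ x ∷ ys
spine-leaves x []       = refl
spine-leaves x (y ∷ ys) = cong (x ∷_) (spine-leaves y ys)

spine-cherries : ∀ x y ys → cherries (spine x (y ∷ ys)) ≡ 1
spine-cherries x y []       = refl
spine-cherries x y (z ∷ zs) = spine-cherries y z zs

displays-outgroup : ∀ t r → a t ∈ leaves r → b t ∈ leaves r → Displays (node (leaf (c t)) r) t
displays-outgroup t r a∈r b∈r =
  true ∷ pa , true ∷ pb , false ∷ [] , right La , right Lb , left here , refl , stop
  where
  pa = proj₁ (leaf-leafAt r a∈r)
  La = proj₂ (leaf-leafAt r a∈r)
  pb = proj₁ (leaf-leafAt r b∈r)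
  Lb = proj₂ (leaf-leafAt r b∈r)

displays-in-right : ∀ {l r} t → Displays r t → Displays (node l r) t
displays-in-right t (pa , pb , pc , La , Lb , Lc , eq , anc) =
  true ∷ pa , true ∷ pb , true ∷ pc , right La , right Lb , right Lc , cong (true ∷_) eq , step anc

-- If the arcs c→a and c→b of some digraph respect the order x, ys of
-- labels, then c comes before a and b, so the spine on x, ys displays ab|c.
spine-displays : ∀ (E : Rel Label 0ℓ) t → E (c t) (a t) → E (c t) (b t)
               → ∀ x ys → Topological E (x ∷ ys)
               → a t ∈ x ∷ ys → b t ∈ x ∷ ys → c t ∈ x ∷ ys → Displays (spine x ys) t
spine-displays E t c→a c→b x [] _ (here a≡x) _ (here c≡x) = ⊥-elim (a≢c t (trans a≡x (sym c≡x)))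
spine-displays E t c→a c→b x (y ∷ ys) _ (here a≡x) _ (here c≡x) = ⊥-elim (a≢c t (trans a≡x (sym c≡x)))
spine-displays E t c→a c→b x (y ∷ ys) _ (there _) (here b≡x) (here c≡x) =
  ⊥-elim (b≢c t (trans b≡x (sym c≡x)))
spine-displays E t c→a c→b x (y ∷ ys) _ (there a∈ys) (there b∈ys) (here refl) =
  displays-outgroup t (spine y ys) (subst (a t ∈_) (sym (spine-leaves y ys)) a∈ys)
                                   (subst (b t ∈_) (sym (spine-leaves y ys)) b∈ys)
spine-displays E t c→a c→b x (y ∷ ys) (noneBefore ∷ _) (here refl) _ (there c∈ys) =
  ⊥-elim (All.lookup noneBefore c∈ys c→a)
spine-displays E t c→a c→b x (y ∷ ys) (noneBefore ∷ _) (there _) (here refl) (there c∈ys) =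
  ⊥-elim (All.lookup noneBefore c∈ys c→b)
spine-displays E t c→a c→b x (y ∷ ys) (_ ∷ topo) (there a∈ys) (there b∈ys) (there c∈ys) =
  displays-in-right t (spine-displays E t c→a c→b y ys topo a∈ys b∈ys c∈ys)

labels : List Triplet → List Label
labels []      = []
labels (t ∷ R) = a t ∷ b t ∷ c t ∷ labels R

∈-labels : ∀ R x → x ∈ labels R ⇔ x ∈L R
∈-labels R x = mk⇔ (to R) (from R)
  where
  to : ∀ R → x ∈ labels R → x ∈L R
  to (t ∷ R) (here e)                 = t , here refl , inj₁ e
  to (t ∷ R) (there (here e))         = t , here refl , inj₂ (inj₁ e)
  to (t ∷ R) (there (there (here e))) = t , here refl , inj₂ (inj₂ e)
  to (t ∷ R) (there (there (there m))) with t′ , t′∈R , e ← to R m = t′ , there t′∈R , e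
  from : ∀ R → x ∈L R → x ∈ labels R
  from (t ∷ R) (_ , here refl , inj₁ e)        = here e
  from (t ∷ R) (_ , here refl , inj₂ (inj₁ e)) = there (here e)
  from (t ∷ R) (_ , here refl , inj₂ (inj₂ e)) = there (there (here e))
  from (t ∷ R) (t′ , there t′∈R , e)           = there (there (there (from R (t′ , t′∈R , e))))

arc? : ∀ R → Decidable (Arc R)
arc? R u v = map′ find (λ (t , t∈R , arc) → lose t∈R arc)
                  (any? (λ t → (u ≟ c t) ×-dec ((v ≟ a t) ⊎-dec (v ≟ b t))) R)

-- An acyclic D(R) of a non-empty R yields a caterpillar displaying R: the
-- spine on a topological order of the labels.
acyclic-caterpillar : ∀ R → R ≢ [] → Acyclic R → CaterpillarCompatible R
acyclic-caterpillar [] R≢[] _ = ⊥-elim (R≢[] refl)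
acyclic-caterpillar R@(t ∷ _) _ acyclic
  with L , L⇔labels , uniq , topo ← topological-sort _≟_ (Arc R) (arc? R) acyclic (labels R)
  = spine-on L (λ x → ∈-labels R x ⇔-∘ L⇔labels x) uniq topo
  where
  occurs : ∀ {L} → (∀ x → x ∈ L ⇔ x ∈L R)
         → ∀ {s x} → s ∈ R → x ≡ a s ⊎ x ≡ b s ⊎ x ≡ c s → x ∈ L
  occurs L⇔R s∈R x∈s = Equivalence.from (L⇔R _) (_ , s∈R , x∈s)

  -- L contains the distinct labels a t and b t, so it has length at least 2
  spine-on : ∀ L → (∀ x → x ∈ L ⇔ x ∈L R) → Unique L → Topological (Arc R) L
           → CaterpillarCompatible R
  spine-on [] L⇔R _ _ with () ← occurs L⇔R (here refl) (inj₁ refl)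
  spine-on (x ∷ []) L⇔R _ _
    with here a≡x ← occurs L⇔R (here refl) (inj₁ refl)
       | here b≡x ← occurs L⇔R (here refl) (inj₂ (inj₁ refl)) = ⊥-elim (a≢b t (trans a≡x (sym b≡x)))
  spine-on (x ∷ y ∷ zs) L⇔R uniq topo =
    spine x (y ∷ zs) , ((isNode , unique-leaves , same-labels) , spine-cherries x y zs) , displays
    where
    unique-leaves : Unique (leaves (spine x (y ∷ zs)))
    unique-leaves = subst Unique (sym (spine-leaves x (y ∷ zs))) uniq

    same-labels : ∀ w → w ∈ leaves (spine x (y ∷ zs)) ⇔ w ∈L R
    same-labels w rewrite spine-leaves x (y ∷ zs) = L⇔R w

    displays : ∀ s → s ∈ R → Displays (spine x (y ∷ zs)) s
    displays s s∈R =
      spine-displays (Arc R) s (s , s∈R , refl , inj₁ refl) (s , s∈R , refl , inj₂ refl) x (y ∷ zs) topo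
        (occurs L⇔R s∈R (inj₁ refl)) (occurs L⇔R s∈R (inj₂ (inj₁ refl))) (occurs L⇔R s∈R (inj₂ (inj₂ refl)))

lemma22 : (R : List Triplet) → R ≢ [] → (CaterpillarCompatible R ⇔ Acyclic R)
lemma22 R R≢[] = mk⇔ compatible⇒acyclic (acyclic-caterpillar R R≢[])
  where
  compatible⇒acyclic : CaterpillarCompatible R → Acyclic R
  compatible⇒acyclic (T , ((_ , uniq , _) , one-cherry) , displays) =
    caterpillar-acyclic R T (caterpillar-shape T (subst (_≤ 1) (sym one-cherry) ≤-refl)) uniq displays
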